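{- Let $s > 3$ be an integer and set $V_2 = \{0,1,\ldots,\lfloor 2^{s/4}\rfloor\}$. Then there is a coloring $\phi_2:\binom{V_2}{2}\to\{\alpha_1,\alpha_2,\alpha_3\}$ of the pairs of $V_2$ with 3 colors such that every subset of $V_2$ of size $s$ contains pairs of at least three distinct colors. -}

module Defs where

open import Data.Nat using (ℕ; suc)
open import Data.Fin using (Fin; _<_)
open import Data.Fin.Subset using (Subset; _∈_)
open import Data.Product using (∃-syntax; _×_)
open import Relation.Binary.PropositionalEquality using (_≡_)

-- A 3-colouring of the 2-element subsets of Fin n = {0,…,n-1}:
-- the pair {i,j} with i < j receives colour  c i j.
-- (Values c i j with i ≥ j are irrelevant and never inspected.)
PairColouring : ℕ → Set
PairColouring n = Fin n → Fin n → Fin 3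

ColourOccursIn : ∀ {n} → PairColouring n → Subset n → Fin 3 → Set
ColourOccursIn {n} c S k = ∃[ i ] ∃[ j ] (i < j × i ∈ S × j ∈ S × c i j ≡ k)

module Submission where

-- Proof by the first-moment method, done by exact counting.  Colourings are
-- encoded as triangular tables of colours; there are 3^T(n) of them, where
-- T(n) = n(n-1)/2.  For an s-set S and a colour k exactly a (2/3)^T(s)
-- fraction of the tables avoid k inside S, so the "defects" (S, k) of all
-- tables number 3 C(n,s) (2/3)^T(s) times the number of tables.  When
-- 3 C(n,s) 2^T(s) < 3^T(s), averaging gives a table without defects.

open import Defs
open import Data.Nat using (ℕ; zero; suc; _+_; _*_; _^_; _≤_; _<_; _≤′_; ≤′-refl; ≤′-step; _∸_; z≤n; s≤s; s≤s⁻¹; _≤?_)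
open import Data.Nat.Properties hiding (_≟_)
open import Data.Nat.Solver using (module +-*-Solver)
open import Data.Fin using (Fin; zero; suc; _≟_)
open import Data.Fin.Subset using (Subset; ∣_∣; _∈_)
open import Data.Fin.Subset.Properties using (∣p∣≤n)
open import Data.Vec using (Vec; []; _∷_; lookup; here; there)
open import Data.Bool using (Bool; true; false; _∧_; _∨_)
open import Data.Unit using (⊤; tt)
open import Data.Product using (Σ-syntax; ∃-syntax; _×_; _,_; proj₁; proj₂; uncurry)
open import Data.Empty using (⊥-elim)
open import Relation.Nullary using (yes; no; does)
open import Relation.Binary.PropositionalEquality
open +-*-Solver using (solve; _:+_; _:*_; _:=_; _:^_; con)

private
  variable
    A B : Set
    n : ℕ

record Summation (A : Set) : Set where
  field
    ∑      : (A → ℕ) → ℕ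
    ∑-cong : ∀ {f g} → (∀ a → f a ≡ g a) → ∑ f ≡ ∑ g
    ∑-+    : ∀ f g → ∑ (λ a → f a + g a) ≡ ∑ f + ∑ g
    ∑-*    : ∀ k f → ∑ (λ a → k * f a) ≡ k * ∑ f
    ∑-<    : ∀ f g → ∑ f < ∑ g → ∃[ a ] f a < g a
open Summation public

size : Summation A → ℕ
size S = ∑ S (λ _ → 1)

∑-*ʳ : (S : Summation A) → ∀ f k → ∑ S (λ a → f a * k) ≡ ∑ S f * k
∑-*ʳ S f k = begin
  ∑ S (λ a → f a * k) ≡⟨ ∑-cong S (λ a → *-comm (f a) k) ⟩
  ∑ S (λ a → k * f a) ≡⟨ ∑-* S k f ⟩
  k * ∑ S f           ≡⟨ *-comm k (∑ S f) ⟩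
  ∑ S f * k           ∎
  where open ≡-Reasoning

∑-const : (S : Summation A) → ∀ k → ∑ S (λ _ → k) ≡ size S * k
∑-const S k = begin
  ∑ S (λ _ → k)     ≡⟨ ∑-cong S (λ _ → sym (*-identityˡ k)) ⟩
  ∑ S (λ _ → 1 * k) ≡⟨ ∑-*ʳ S (λ _ → 1) k ⟩
  size S * k        ∎
  where open ≡-Reasoning

∑-Fin3 : Summation (Fin 3)
∑-Fin3 = record
  { ∑      = λ f → f zero + (f (suc zero) + f (suc (suc zero)))
  ; ∑-cong = λ e → cong₂ _+_ (e zero) (cong₂ _+_ (e (suc zero)) (e (suc (suc zero))))
  ; ∑-+    = λ f g → solve 6 (λ a b c x y z → (a :+ x) :+ ((b :+ y) :+ (c :+ z))
                                             := (a :+ (b :+ c)) :+ (x :+ (y :+ z))) refl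
                       (f zero) (f (suc zero)) (f (suc (suc zero)))
                       (g zero) (g (suc zero)) (g (suc (suc zero)))
  ; ∑-*    = λ k f → sym (trans (*-distribˡ-+ k (f zero) _) (cong (k * f zero +_) (*-distribˡ-+ k _ _)))
  ; ∑-<    = average
  }
  where
  average : ∀ f g → f zero + (f (suc zero) + f (suc (suc zero)))
                      < g zero + (g (suc zero) + g (suc (suc zero))) → ∃[ a ] f a < g a
  average f g lt with f zero <? g zero | f (suc zero) <? g (suc zero) | f (suc (suc zero)) <? g (suc (suc zero))
  ... | yes p | _     | _     = zero , p
  ... | no _  | yes p | _     = suc zero , p
  ... | no _  | no _  | yes p = suc (suc zero) , p
  ... | no p₀ | no p₁ | no p₂ = ⊥-elim (<⇒≱ lt (+-mono-≤ (≮⇒≥ p₀) (+-mono-≤ (≮⇒≥ p₁) (≮⇒≥ p₂))))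

∑-Fin3-term : ∀ f k → f k ≤ ∑ ∑-Fin3 f
∑-Fin3-term f zero             = m≤m+n _ _
∑-Fin3-term f (suc zero)       = ≤-trans (m≤m+n _ _) (m≤n+m _ (f zero))
∑-Fin3-term f (suc (suc zero)) = ≤-trans (m≤n+m _ _) (m≤n+m _ (f zero))

∑-⊤ : Summation ⊤
∑-⊤ = record
  { ∑ = λ f → f tt ; ∑-cong = λ e → e tt ; ∑-+ = λ _ _ → refl ; ∑-* = λ _ _ → refl
  ; ∑-< = λ _ _ lt → tt , lt }

∑-× : Summation A → Summation B → Summation (A × B)
∑-× SA SB = record
  { ∑      = λ f → ∑ SA (λ a → ∑ SB (λ b → f (a , b)))
  ; ∑-cong = λ e → ∑-cong SA (λ a → ∑-cong SB (λ b → e (a , b)))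
  ; ∑-+    = λ f g → trans (∑-cong SA (λ a → ∑-+ SB (λ b → f (a , b)) (λ b → g (a , b)))) (∑-+ SA _ _)
  ; ∑-*    = λ k f → trans (∑-cong SA (λ a → ∑-* SB k (λ b → f (a , b)))) (∑-* SA k _)
  ; ∑-<    = λ f g lt → let (a , lt′) = ∑-< SA _ _ lt ; (b , lt″) = ∑-< SB _ _ lt′ in (a , b) , lt″
  }

-- Summing over the image of a map: ∑_B f = ∑_A (f ∘ g).  (Used with bijections.)
reindex : (A → B) → Summation A → Summation B
reindex g S = record
  { ∑      = λ f → ∑ S (λ a → f (g a))
  ; ∑-cong = λ e → ∑-cong S (λ a → e (g a))
  ; ∑-+    = λ f g′ → ∑-+ S _ _
  ; ∑-*    = λ k f → ∑-* S k _
  ; ∑-<    = λ f g′ lt → let (a , lt′) = ∑-< S _ _ lt in g a , lt′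
  }

∑-Vec : Summation A → ∀ n → Summation (Vec A n)
∑-Vec S zero    = reindex (λ _ → []) ∑-⊤
∑-Vec S (suc n) = reindex (uncurry _∷_) (∑-× S (∑-Vec S n))

∑-⊗ : (SA : Summation A) (SB : Summation B) → ∀ f g →
      ∑ (∑-× SA SB) (λ p → f (proj₁ p) * g (proj₂ p)) ≡ ∑ SA f * ∑ SB g
∑-⊗ SA SB f g = begin
  ∑ SA (λ a → ∑ SB (λ b → f a * g b)) ≡⟨ ∑-cong SA (λ a → ∑-* SB (f a) g) ⟩
  ∑ SA (λ a → f a * ∑ SB g)           ≡⟨ ∑-*ʳ SA f (∑ SB g) ⟩
  ∑ SA f * ∑ SB g                     ∎
  where open ≡-Reasoning

size-Vec : (S : Summation A) → ∀ n → size (∑-Vec S n) ≡ size S ^ n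
size-Vec S zero    = refl
size-Vec S (suc n) = trans (∑-const S (size (∑-Vec S n))) (cong (size S *_) (size-Vec S n))

∑-∑Fin3 : (S : Summation A) → ∀ (F : A → Fin 3 → ℕ) →
          ∑ S (λ a → ∑ ∑-Fin3 (F a)) ≡ ∑ ∑-Fin3 (λ k → ∑ S (λ a → F a k))
∑-∑Fin3 S F = trans (∑-+ S _ _) (cong (∑ S (λ a → F a zero) +_) (∑-+ S _ _))

∑Subsets : ∀ n → ℕ → (Subset n → ℕ) → ℕ
∑Subsets zero    zero    f = f []
∑Subsets zero    (suc s) f = 0
∑Subsets (suc n) zero    f = ∑Subsets n zero (λ S → f (false ∷ S))
∑Subsets (suc n) (suc s) f = ∑Subsets n (suc s) (λ S → f (false ∷ S)) + ∑Subsets n s (λ S → f (true ∷ S))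

#subsets : ℕ → ℕ → ℕ
#subsets n s = ∑Subsets n s (λ _ → 1)

∑Subsets-cong : ∀ n s {f g : Subset n → ℕ} → (∀ S → ∣ S ∣ ≡ s → f S ≡ g S) →
                ∑Subsets n s f ≡ ∑Subsets n s g
∑Subsets-cong zero    zero    e = e [] refl
∑Subsets-cong zero    (suc s) e = refl
∑Subsets-cong (suc n) zero    e = ∑Subsets-cong n zero (λ S → e (false ∷ S))
∑Subsets-cong (suc n) (suc s) e =
  cong₂ _+_ (∑Subsets-cong n (suc s) (λ S → e (false ∷ S))) (∑Subsets-cong n s (λ S p → e (true ∷ S) (cong suc p)))

∑Subsets-*ʳ : ∀ n s (f : Subset n → ℕ) k → ∑Subsets n s (λ S → f S * k) ≡ ∑Subsets n s f * k
∑Subsets-*ʳ zero    zero    f k = refl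
∑Subsets-*ʳ zero    (suc s) f k = refl
∑Subsets-*ʳ (suc n) zero    f k = ∑Subsets-*ʳ n zero _ k
∑Subsets-*ʳ (suc n) (suc s) f k =
  trans (cong₂ _+_ (∑Subsets-*ʳ n (suc s) (λ S → f (false ∷ S)) k) (∑Subsets-*ʳ n s (λ S → f (true ∷ S)) k))
        (sym (*-distribʳ-+ k (∑Subsets n (suc s) (λ S → f (false ∷ S))) _))

∑Subsets-term : ∀ n s (f : Subset n → ℕ) S → ∣ S ∣ ≡ s → f S ≤ ∑Subsets n s f
∑Subsets-term zero    zero    f []          p = ≤-refl
∑Subsets-term (suc n) zero    f (false ∷ S) p = ∑Subsets-term n zero _ S p
∑Subsets-term (suc n) (suc s) f (false ∷ S) p = ≤-trans (∑Subsets-term n (suc s) _ S p) (m≤m+n _ _)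
∑Subsets-term (suc n) (suc s) f (true ∷ S)  p = ≤-trans (∑Subsets-term n s _ S (suc-injective p)) (m≤n+m _ _)

∑-∑Subsets : (Sm : Summation A) → ∀ n s (F : A → Subset n → ℕ) →
             ∑ Sm (λ a → ∑Subsets n s (F a)) ≡ ∑Subsets n s (λ S → ∑ Sm (λ a → F a S))
∑-∑Subsets Sm zero    zero    F = refl
∑-∑Subsets Sm zero    (suc s) F = ∑-* Sm 0 (λ _ → 0)
∑-∑Subsets Sm (suc n) zero    F = ∑-∑Subsets Sm n zero _
∑-∑Subsets Sm (suc n) (suc s) F =
  trans (∑-+ Sm _ _) (cong₂ _+_ (∑-∑Subsets Sm n (suc s) _) (∑-∑Subsets Sm n s _))

#subsets-≤ : ∀ n s → #subsets n s ≤ n ^ s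
#subsets-≤ zero    zero    = ≤-refl
#subsets-≤ zero    (suc s) = z≤n
#subsets-≤ (suc n) zero    = #subsets-≤ n zero
#subsets-≤ (suc n) (suc s) = begin
  #subsets n (suc s) + #subsets n s ≤⟨ +-mono-≤ (#subsets-≤ n (suc s)) (#subsets-≤ n s) ⟩
  n * n ^ s + n ^ s                 ≤⟨ +-mono-≤ (*-monoʳ-≤ n (^-monoˡ-≤ s (n≤1+n n))) (^-monoˡ-≤ s (n≤1+n n)) ⟩
  n * suc n ^ s + suc n ^ s         ≡⟨ +-comm (n * suc n ^ s) _ ⟩
  suc n ^ suc s                     ∎
  where open ≤-Reasoning

-- A table for Fin (suc n) is the row of colours of the pairs {0, j+1},
-- followed by a table for the remaining n vertices.
Table : ℕ → Set
Table zero    = ⊤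
Table (suc n) = Vec (Fin 3) n × Table n

colouring : Table n → PairColouring n
colouring {suc n} (row , rest) zero    (suc j) = lookup row j
colouring {suc n} (row , rest) (suc i) (suc j) = colouring rest i j
colouring {suc n} _            _       zero    = zero

∑-Table : ∀ n → Summation (Table n)
∑-Table zero    = ∑-⊤
∑-Table (suc n) = ∑-× (∑-Vec ∑-Fin3 n) (∑-Table n)

pairs : ℕ → ℕ
pairs zero    = 0
pairs (suc n) = n + pairs n

size-Table : ∀ n → size (∑-Table n) ≡ 3 ^ pairs n
size-Table zero    = refl
size-Table (suc n) = begin
  ∑ (∑-Vec ∑-Fin3 n) (λ _ → size (∑-Table n)) ≡⟨ ∑-const (∑-Vec ∑-Fin3 n) _ ⟩
  size (∑-Vec ∑-Fin3 n) * size (∑-Table n)    ≡⟨ cong₂ _*_ (size-Vec ∑-Fin3 n) (size-Table n) ⟩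
  3 ^ n * 3 ^ pairs n                         ≡⟨ sym (^-distribˡ-+-* 3 n (pairs n)) ⟩
  3 ^ (n + pairs n)                           ∎
  where open ≡-Reasoning

rowHits : Vec (Fin 3) n → Subset n → Fin 3 → Bool
rowHits []        []      k = false
rowHits (a ∷ row) (b ∷ S) k = (b ∧ does (a ≟ k)) ∨ rowHits row S k

tableHits : Table n → Subset n → Fin 3 → Bool
tableHits {zero}  _            []      k = false
tableHits {suc n} (row , rest) (b ∷ S) k = (b ∧ rowHits row S k) ∨ tableHits rest S k

rowHits-sound : ∀ (row : Vec (Fin 3) n) S k → rowHits row S k ≡ true →
                ∃[ j ] (j ∈ S × lookup row j ≡ k)
rowHits-sound []        []         k ()
rowHits-sound (a ∷ row) (true ∷ S) k hit with a ≟ k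
... | yes a≡k = zero , here , a≡k
... | no _    = let (j , j∈S , rj≡k) = rowHits-sound row S k hit in suc j , there j∈S , rj≡k
rowHits-sound (a ∷ row) (false ∷ S) k hit =
  let (j , j∈S , rj≡k) = rowHits-sound row S k hit in suc j , there j∈S , rj≡k

occurs-in-rest : ∀ (row : Vec (Fin 3) n) (rest : Table n) b S k →
                 ColourOccursIn (colouring rest) S k → ColourOccursIn (colouring (row , rest)) (b ∷ S) k
occurs-in-rest row rest b S k (i , j , i<j , i∈S , j∈S , cij≡k) =
  suc i , suc j , s≤s i<j , there i∈S , there j∈S , cij≡k

tableHits-sound : ∀ (c : Table n) S k → tableHits c S k ≡ true → ColourOccursIn (colouring c) S k
tableHits-sound {suc n} (row , rest) (b ∷ S) k hit with b | rowHits row S k in rowHit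
... | true  | true  = let (j , j∈S , rj≡k) = rowHits-sound row S k rowHit
                      in zero , suc j , s≤s z≤n , here , there j∈S , rj≡k
... | true  | false = occurs-in-rest row rest true S k (tableHits-sound rest S k hit)
... | false | _     = occurs-in-rest row rest false S k (tableHits-sound rest S k hit)

absent : Bool → ℕ
absent true  = 0
absent false = 1

absent-∨ : ∀ x y → absent (x ∨ y) ≡ absent x * absent y
absent-∨ true  y = refl
absent-∨ false y = sym (+-identityʳ (absent y))

absent<1 : ∀ x → absent x < 1 → x ≡ true
absent<1 true  _        = refl
absent<1 false (s≤s ())

-- Number of colours available at one position of a row that must avoid k:
-- two inside S, three outside.
choices : Bool → ℕ
choices true  = 2
choices false = 3

choices-count : ∀ b k → ∑ ∑-Fin3 (λ a → absent (b ∧ does (a ≟ k))) ≡ choices b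
choices-count true  zero             = refl
choices-count true  (suc zero)       = refl
choices-count true  (suc (suc zero)) = refl
choices-count false k                = refl

rowAvoiders : Subset n → ℕ
rowAvoiders []      = 1
rowAvoiders (b ∷ S) = choices b * rowAvoiders S

count-rows : ∀ (S : Subset n) k → ∑ (∑-Vec ∑-Fin3 n) (λ row → absent (rowHits row S k)) ≡ rowAvoiders S
count-rows []              k = refl
count-rows {suc n} (b ∷ S) k = begin
  ∑ Rows (λ p → absent ((b ∧ does (proj₁ p ≟ k)) ∨ rowHits (proj₂ p) S k))
    ≡⟨ ∑-cong Rows (λ p → absent-∨ (b ∧ does (proj₁ p ≟ k)) (rowHits (proj₂ p) S k)) ⟩
  ∑ Rows (λ p → absent (b ∧ does (proj₁ p ≟ k)) * absent (rowHits (proj₂ p) S k))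
    ≡⟨ ∑-⊗ ∑-Fin3 (∑-Vec ∑-Fin3 n) (λ a → absent (b ∧ does (a ≟ k))) (λ row → absent (rowHits row S k)) ⟩
  ∑ ∑-Fin3 (λ a → absent (b ∧ does (a ≟ k))) * ∑ (∑-Vec ∑-Fin3 n) (λ row → absent (rowHits row S k))
    ≡⟨ cong₂ _*_ (choices-count b k) (count-rows S k) ⟩
  choices b * rowAvoiders S ∎
  where
  open ≡-Reasoning
  Rows : Summation (Fin 3 × Vec (Fin 3) n)
  Rows = ∑-× ∑-Fin3 (∑-Vec ∑-Fin3 n)

tableAvoiders : Subset n → ℕ
tableAvoiders []                  = 1
tableAvoiders         (true ∷ S)  = rowAvoiders S * tableAvoiders S
tableAvoiders {suc n} (false ∷ S) = 3 ^ n * tableAvoiders S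

count-tables : ∀ (S : Subset n) k → ∑ (∑-Table n) (λ c → absent (tableHits c S k)) ≡ tableAvoiders S
count-tables []              k = refl
count-tables {suc n} (b ∷ S) k = begin
  ∑ (∑-Table (suc n)) (λ p → absent ((b ∧ rowHits (proj₁ p) S k) ∨ tableHits (proj₂ p) S k))
    ≡⟨ ∑-cong (∑-Table (suc n)) (λ p → absent-∨ (b ∧ rowHits (proj₁ p) S k) (tableHits (proj₂ p) S k)) ⟩
  ∑ (∑-Table (suc n)) (λ p → absent (b ∧ rowHits (proj₁ p) S k) * absent (tableHits (proj₂ p) S k))
    ≡⟨ ∑-⊗ (∑-Vec ∑-Fin3 n) (∑-Table n) (λ row → absent (b ∧ rowHits row S k)) (λ c → absent (tableHits c S k)) ⟩
  ∑ (∑-Vec ∑-Fin3 n) (λ row → absent (b ∧ rowHits row S k)) * ∑ (∑-Table n) (λ c → absent (tableHits c S k))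
    ≡⟨ cong (∑ (∑-Vec ∑-Fin3 n) (λ row → absent (b ∧ rowHits row S k)) *_) (count-tables S k) ⟩
  ∑ (∑-Vec ∑-Fin3 n) (λ row → absent (b ∧ rowHits row S k)) * tableAvoiders S
    ≡⟨ first-row b ⟩
  tableAvoiders (b ∷ S) ∎
  where
  open ≡-Reasoning
  -- The first row is constrained only when vertex 0 lies in S.
  first-row : ∀ b → ∑ (∑-Vec ∑-Fin3 n) (λ row → absent (b ∧ rowHits row S k)) * tableAvoiders S
                    ≡ tableAvoiders (b ∷ S)
  first-row true  = cong (_* tableAvoiders S) (count-rows S k)
  first-row false = cong (_* tableAvoiders S)
    (trans (∑-const (∑-Vec ∑-Fin3 n) 1) (trans (*-identityʳ _) (size-Vec ∑-Fin3 n)))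

rowAvoiders-closed : ∀ (S : Subset n) → rowAvoiders S * 3 ^ ∣ S ∣ ≡ 2 ^ ∣ S ∣ * 3 ^ n
rowAvoiders-closed []                = refl
rowAvoiders-closed {suc n} (true ∷ S) = begin
  2 * rowAvoiders S * (3 * 3 ^ ∣ S ∣) ≡⟨ solve 2 (λ r a → con 2 :* r :* (con 3 :* a) := con 6 :* (r :* a)) refl (rowAvoiders S) (3 ^ ∣ S ∣) ⟩
  6 * (rowAvoiders S * 3 ^ ∣ S ∣)     ≡⟨ cong (6 *_) (rowAvoiders-closed S) ⟩
  6 * (2 ^ ∣ S ∣ * 3 ^ n)             ≡⟨ solve 2 (λ b c → con 6 :* (b :* c) := con 2 :* b :* (con 3 :* c)) refl (2 ^ ∣ S ∣) (3 ^ n) ⟩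
  2 * 2 ^ ∣ S ∣ * (3 * 3 ^ n)         ∎
  where open ≡-Reasoning
rowAvoiders-closed {suc n} (false ∷ S) = begin
  3 * rowAvoiders S * 3 ^ ∣ S ∣       ≡⟨ *-assoc 3 (rowAvoiders S) _ ⟩
  3 * (rowAvoiders S * 3 ^ ∣ S ∣)     ≡⟨ cong (3 *_) (rowAvoiders-closed S) ⟩
  3 * (2 ^ ∣ S ∣ * 3 ^ n)             ≡⟨ solve 2 (λ b c → con 3 :* (b :* c) := b :* (con 3 :* c)) refl (2 ^ ∣ S ∣) (3 ^ n) ⟩
  2 ^ ∣ S ∣ * (3 * 3 ^ n)             ∎
  where open ≡-Reasoning

tableAvoiders-closed : ∀ (S : Subset n) → tableAvoiders S * 3 ^ pairs ∣ S ∣ ≡ 2 ^ pairs ∣ S ∣ * 3 ^ pairs n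
tableAvoiders-closed []                = refl
tableAvoiders-closed {suc n} (true ∷ S) = begin
  r * t * 3 ^ (∣ S ∣ + pairs ∣ S ∣)        ≡⟨ cong (r * t *_) (^-distribˡ-+-* 3 ∣ S ∣ (pairs ∣ S ∣)) ⟩
  r * t * (3 ^ ∣ S ∣ * 3 ^ pairs ∣ S ∣)    ≡⟨ solve 4 (λ r t a b → r :* t :* (a :* b) := (r :* a) :* (t :* b)) refl r t _ _ ⟩
  (r * 3 ^ ∣ S ∣) * (t * 3 ^ pairs ∣ S ∣)  ≡⟨ cong₂ _*_ (rowAvoiders-closed S) (tableAvoiders-closed S) ⟩
  (2 ^ ∣ S ∣ * 3 ^ n) * (2 ^ pairs ∣ S ∣ * 3 ^ pairs n)
    ≡⟨ solve 4 (λ a b c d → (a :* b) :* (c :* d) := (a :* c) :* (b :* d)) refl (2 ^ ∣ S ∣) (3 ^ n) _ _ ⟩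
  (2 ^ ∣ S ∣ * 2 ^ pairs ∣ S ∣) * (3 ^ n * 3 ^ pairs n)
    ≡⟨ sym (cong₂ _*_ (^-distribˡ-+-* 2 ∣ S ∣ _) (^-distribˡ-+-* 3 n _)) ⟩
  2 ^ (∣ S ∣ + pairs ∣ S ∣) * 3 ^ (n + pairs n) ∎
  where
  open ≡-Reasoning
  r t : ℕ
  r = rowAvoiders S
  t = tableAvoiders S
tableAvoiders-closed {suc n} (false ∷ S) = begin
  3 ^ n * t * 3 ^ pairs ∣ S ∣             ≡⟨ *-assoc (3 ^ n) t _ ⟩
  3 ^ n * (t * 3 ^ pairs ∣ S ∣)           ≡⟨ cong (3 ^ n *_) (tableAvoiders-closed S) ⟩
  3 ^ n * (2 ^ pairs ∣ S ∣ * 3 ^ pairs n) ≡⟨ solve 3 (λ a b c → a :* (b :* c) := b :* (a :* c)) refl (3 ^ n) (2 ^ pairs ∣ S ∣) (3 ^ pairs n) ⟩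
  2 ^ pairs ∣ S ∣ * (3 ^ n * 3 ^ pairs n) ≡⟨ cong (2 ^ pairs ∣ S ∣ *_) (sym (^-distribˡ-+-* 3 n (pairs n))) ⟩
  2 ^ pairs ∣ S ∣ * 3 ^ (n + pairs n)     ∎
  where
  open ≡-Reasoning
  t : ℕ
  t = tableAvoiders S

defects : ∀ n s → Table n → ℕ
defects n s c = ∑Subsets n s (λ S → ∑ ∑-Fin3 (λ k → absent (tableHits c S k)))

total-defects : ∀ n s → ∑ (∑-Table n) (defects n s) * 3 ^ pairs s
                        ≡ #subsets n s * (3 * 2 ^ pairs s * 3 ^ pairs n)
total-defects n s = begin
  ∑ Tables (defects n s) * 3 ^ pairs s
    ≡⟨ cong (_* 3 ^ pairs s) (∑-∑Subsets Tables n s _) ⟩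
  ∑Subsets n s (λ S → ∑ Tables (λ c → ∑ ∑-Fin3 (λ k → absent (tableHits c S k)))) * 3 ^ pairs s
    ≡⟨ sym (∑Subsets-*ʳ n s _ (3 ^ pairs s)) ⟩
  ∑Subsets n s (λ S → ∑ Tables (λ c → ∑ ∑-Fin3 (λ k → absent (tableHits c S k))) * 3 ^ pairs s)
    ≡⟨ ∑Subsets-cong n s per-subset ⟩
  ∑Subsets n s (λ _ → 1 * (3 * 2 ^ pairs s * 3 ^ pairs n))
    ≡⟨ ∑Subsets-*ʳ n s (λ _ → 1) _ ⟩
  #subsets n s * (3 * 2 ^ pairs s * 3 ^ pairs n) ∎
  where
  open ≡-Reasoning
  Tables : Summation (Table n)
  Tables = ∑-Table n
  -- Each s-subset is missed by each colour in the same number of tables.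
  per-subset : ∀ S → ∣ S ∣ ≡ s →
    ∑ Tables (λ c → ∑ ∑-Fin3 (λ k → absent (tableHits c S k))) * 3 ^ pairs s ≡ 1 * (3 * 2 ^ pairs s * 3 ^ pairs n)
  per-subset S refl = begin
    ∑ Tables (λ c → ∑ ∑-Fin3 (λ k → absent (tableHits c S k))) * 3 ^ pairs ∣ S ∣
      ≡⟨ cong (_* 3 ^ pairs ∣ S ∣) (∑-∑Fin3 Tables (λ c k → absent (tableHits c S k))) ⟩
    ∑ ∑-Fin3 (λ k → ∑ Tables (λ c → absent (tableHits c S k))) * 3 ^ pairs ∣ S ∣
      ≡⟨ cong (_* 3 ^ pairs ∣ S ∣) (∑-cong ∑-Fin3 (count-tables S)) ⟩
    (t + (t + t)) * 3 ^ pairs ∣ S ∣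
      ≡⟨ solve 2 (λ t a → (t :+ (t :+ t)) :* a := con 3 :* (t :* a)) refl t (3 ^ pairs ∣ S ∣) ⟩
    3 * (t * 3 ^ pairs ∣ S ∣)
      ≡⟨ cong (3 *_) (tableAvoiders-closed S) ⟩
    3 * (2 ^ pairs ∣ S ∣ * 3 ^ pairs n)
      ≡⟨ solve 2 (λ a b → con 3 :* (a :* b) := con 1 :* (con 3 :* a :* b)) refl (2 ^ pairs ∣ S ∣) (3 ^ pairs n) ⟩
    1 * (3 * 2 ^ pairs ∣ S ∣ * 3 ^ pairs n) ∎
    where
    t : ℕ
    t = tableAvoiders S

few-defects : ∀ n s → 3 * #subsets n s * 2 ^ pairs s < 3 ^ pairs s →
              ∑ (∑-Table n) (defects n s) < ∑ (∑-Table n) (λ _ → 1)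
few-defects n s condition = *-cancelʳ-< (3 ^ pairs s) _ _ (begin-strict
  ∑ (∑-Table n) (defects n s) * 3 ^ pairs s     ≡⟨ total-defects n s ⟩
  #subsets n s * (3 * 2 ^ pairs s * 3 ^ pairs n) ≡⟨ solve 3 (λ c a b → c :* (con 3 :* a :* b) := con 3 :* c :* a :* b) refl (#subsets n s) (2 ^ pairs s) (3 ^ pairs n) ⟩
  3 * #subsets n s * 2 ^ pairs s * 3 ^ pairs n   <⟨ *-monoˡ-< (3 ^ pairs n) {{m^n≢0 3 (pairs n)}} condition ⟩
  3 ^ pairs s * 3 ^ pairs n                      ≡⟨ cong (3 ^ pairs s *_) (sym (size-Table n)) ⟩
  3 ^ pairs s * size (∑-Table n)                 ≡⟨ *-comm (3 ^ pairs s) _ ⟩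
  size (∑-Table n) * 3 ^ pairs s                 ∎)
  where open ≤-Reasoning

defect-free : ∀ n s (c : Table n) → defects n s c < 1 →
              ∀ S → ∣ S ∣ ≡ s → ∀ k → ColourOccursIn (colouring c) S k
defect-free n s c no-defect S ∣S∣≡s k = tableHits-sound c S k (absent<1 _ (begin-strict
  absent (tableHits c S k)                            ≤⟨ ∑-Fin3-term (λ k → absent (tableHits c S k)) k ⟩
  ∑ ∑-Fin3 (λ k → absent (tableHits c S k))           ≤⟨ ∑Subsets-term n s _ S ∣S∣≡s ⟩
  defects n s c                                       <⟨ no-defect ⟩
  1                                                   ∎))
  where open ≤-Reasoning

first-moment : ∀ n s → 3 * #subsets n s * 2 ^ pairs s < 3 ^ pairs s →
  Σ[ c ∈ PairColouring n ] ((S : Subset n) → ∣ S ∣ ≡ s → (k : Fin 3) → ColourOccursIn c S k)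
first-moment n s condition =
  let (c , no-defect) = ∑-< (∑-Table n) (defects n s) (λ _ → 1) (few-defects n s condition)
  in colouring c , defect-free n s c no-defect

pairs-double : ∀ s → suc s * s ≡ 2 * (pairs s + s)
pairs-double zero    = refl
pairs-double (suc s) = begin
  suc (suc s) * suc s             ≡⟨ solve 1 (λ s → (con 2 :+ s) :* (con 1 :+ s) := (con 1 :+ s) :* s :+ con 2 :* (con 1 :+ s)) refl s ⟩
  suc s * s + 2 * suc s           ≡⟨ cong (_+ 2 * suc s) (pairs-double s) ⟩
  2 * (pairs s + s) + 2 * suc s   ≡⟨ solve 2 (λ s t → con 2 :* (t :+ s) :+ con 2 :* (con 1 :+ s) := con 2 :* ((s :+ t) :+ (con 1 :+ s))) refl s (pairs s) ⟩
  2 * ((s + pairs s) + suc s)     ∎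
  where open ≡-Reasoning

*-^ : ∀ a b k → (a * b) ^ k ≡ a ^ k * b ^ k
*-^ a b zero    = refl
*-^ a b (suc k) = trans (cong (a * b *_) (*-^ a b k))
  (solve 4 (λ a b x y → a :* b :* (x :* y) := a :* x :* (b :* y)) refl a b (a ^ k) (b ^ k))

^-swap : ∀ a m k → (a ^ m) ^ k ≡ (a ^ k) ^ m
^-swap a m k = trans (^-*-assoc a m k) (trans (cong (a ^_) (*-comm m k)) (sym (^-*-assoc a k m)))

fourth-root-< : ∀ x y → x ^ 4 < y ^ 4 → x < y
fourth-root-< x y x⁴<y⁴ = ≰⇒> (λ y≤x → <⇒≱ x⁴<y⁴ (^-monoˡ-≤ 4 y≤x))

-- (N+1)^4 ≤ 2 N^4 for N ≥ 6, by an explicit polynomial certificate in d = N - 6.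
succ-pow4 : ∀ N → 6 ≤ N → suc N ^ 4 ≤ 2 * N ^ 4
succ-pow4 N 6≤N = subst (λ M → suc M ^ 4 ≤ 2 * M ^ 4) (m+[n∸m]≡n 6≤N) (certificate (N ∸ 6))
  where
  certificate : ∀ d → suc (6 + d) ^ 4 ≤ 2 * (6 + d) ^ 4
  certificate d = subst (suc (6 + d) ^ 4 ≤_) identity (m≤m+n _ (d ^ 4 + 20 * d ^ 3 + 138 * d ^ 2 + 356 * d + 191))
    where
    identity : suc (6 + d) ^ 4 + (d ^ 4 + 20 * d ^ 3 + 138 * d ^ 2 + 356 * d + 191) ≡ 2 * (6 + d) ^ 4
    identity = solve 1 (λ d → (con 7 :+ d) :^ 4 :+ (d :^ 4 :+ con 20 :* d :^ 3 :+ con 138 :* d :^ 2 :+ con 356 :* d :+ con 191)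
                            := con 2 :* (con 6 :+ d) :^ 4) refl d

gap : ∀ {s} → 6 ≤′ s → 4 * 64 ^ s ≤ 81 ^ s
gap ≤′-refl             = ≤ᵇ⇒≤ _ _ tt
gap (≤′-step {s} 6≤′s) = begin
  4 * (64 * 64 ^ s)  ≡⟨ solve 1 (λ x → con 4 :* (con 64 :* x) := con 64 :* (con 4 :* x)) refl (64 ^ s) ⟩
  64 * (4 * 64 ^ s)  ≤⟨ *-monoʳ-≤ 64 (gap 6≤′s) ⟩
  64 * 81 ^ s        ≤⟨ *-monoˡ-≤ (81 ^ s) (≤ᵇ⇒≤ 64 81 tt) ⟩
  81 * 81 ^ s        ∎
  where open ≤-Reasoning

-- 81 · 4^s · 64^T(s) < 81^T(s) for s ≥ 16: checked at s = 16, and each step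
-- multiplies the left side by 4 · 64^s and the right side by 81^s.
growth : ∀ {s} → 16 ≤′ s → 81 * 4 ^ s * 64 ^ pairs s < 81 ^ pairs s
growth ≤′-refl              = ≤ᵇ⇒≤ _ _ tt
growth (≤′-step {s} 16≤′s) = begin-strict
  81 * (4 * 4 ^ s) * 64 ^ (s + pairs s)         ≡⟨ cong (81 * (4 * 4 ^ s) *_) (^-distribˡ-+-* 64 s (pairs s)) ⟩
  81 * (4 * 4 ^ s) * (64 ^ s * 64 ^ pairs s)
    ≡⟨ solve 3 (λ a b c → con 81 :* (con 4 :* a) :* (b :* c) := con 81 :* a :* c :* (con 4 :* b)) refl (4 ^ s) (64 ^ s) (64 ^ pairs s) ⟩
  81 * 4 ^ s * 64 ^ pairs s * (4 * 64 ^ s)      ≤⟨ *-monoʳ-≤ (81 * 4 ^ s * 64 ^ pairs s) (gap 6≤′s) ⟩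
  81 * 4 ^ s * 64 ^ pairs s * 81 ^ s            <⟨ *-monoˡ-< (81 ^ s) {{m^n≢0 81 s}} (growth 16≤′s) ⟩
  81 ^ pairs s * 81 ^ s                         ≡⟨ *-comm (81 ^ pairs s) (81 ^ s) ⟩
  81 ^ s * 81 ^ pairs s                         ≡⟨ sym (^-distribˡ-+-* 81 s (pairs s)) ⟩
  81 ^ (s + pairs s)                            ∎
  where
  open ≤-Reasoning
  6≤′s : 6 ≤′ s
  6≤′s = ≤⇒≤′ (≤-trans (m≤n+m 6 10) (≤′⇒≤ 16≤′s))

-- The first-moment condition with the bound C(n,s) ≤ n^s: if n^4 ≤ 2^(s+1)
-- and s ≥ 16, then 3 n^s 2^T(s) < 3^T(s).  Compared after raising to the 4th power.
union-bound : ∀ n s → 16 ≤ s → n ^ 4 ≤ 2 ^ suc s → 3 * n ^ s * 2 ^ pairs s < 3 ^ pairs s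
union-bound n s 16≤s n⁴≤2ˢ⁺¹ = fourth-root-< (3 * n ^ s * 2 ^ T) (3 ^ T) (begin-strict
  (3 * n ^ s * 2 ^ T) ^ 4         ≡⟨ solve 2 (λ x y → (con 3 :* x :* y) :^ 4 := con 81 :* x :^ 4 :* y :^ 4) refl (n ^ s) (2 ^ T) ⟩
  81 * (n ^ s) ^ 4 * (2 ^ T) ^ 4  ≡⟨ cong₂ (λ x y → 81 * x * y) (^-swap n s 4) (^-swap 2 T 4) ⟩
  81 * (n ^ 4) ^ s * 16 ^ T       ≤⟨ *-monoˡ-≤ (16 ^ T) (*-monoʳ-≤ 81 (^-monoˡ-≤ s n⁴≤2ˢ⁺¹)) ⟩
  81 * (2 ^ suc s) ^ s * 16 ^ T   ≡⟨ cong (λ x → 81 * x * 16 ^ T) powers-of-two ⟩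
  81 * 4 ^ (T + s) * 16 ^ T       ≡⟨ regroup ⟩
  81 * 4 ^ s * 64 ^ T             <⟨ growth (≤⇒≤′ 16≤s) ⟩
  81 ^ T                          ≡⟨ ^-swap 3 4 T ⟩
  (3 ^ T) ^ 4                     ∎)
  where
  open ≤-Reasoning
  T : ℕ
  T = pairs s
  powers-of-two : (2 ^ suc s) ^ s ≡ 4 ^ (T + s)
  powers-of-two = trans (^-*-assoc 2 (suc s) s) (trans (cong (2 ^_) (pairs-double s)) (sym (^-*-assoc 2 2 (T + s))))
  regroup : 81 * 4 ^ (T + s) * 16 ^ T ≡ 81 * 4 ^ s * 64 ^ T
  regroup = begin-equality
    81 * 4 ^ (T + s) * 16 ^ T       ≡⟨ cong (λ x → 81 * x * 16 ^ T) (^-distribˡ-+-* 4 T s) ⟩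
    81 * (4 ^ T * 4 ^ s) * 16 ^ T   ≡⟨ solve 3 (λ a b c → con 81 :* (a :* b) :* c := con 81 :* b :* (a :* c)) refl (4 ^ T) (4 ^ s) (16 ^ T) ⟩
    81 * 4 ^ s * (4 ^ T * 16 ^ T)   ≡⟨ cong (81 * 4 ^ s *_) (sym (*-^ 4 16 T)) ⟩
    81 * 4 ^ s * 64 ^ T             ∎

fifteen≤ : ∀ a → 3 ≤ a → a ^ 4 ≤ 2 ^ suc a → 15 ≤ a
fifteen≤ 1  (s≤s ())       _
fifteen≤ 2  (s≤s (s≤s ())) _
fifteen≤ 3  _ h = ⊥-elim (≤⇒≤ᵇ h)
fifteen≤ 4  _ h = ⊥-elim (≤⇒≤ᵇ h)
fifteen≤ 5  _ h = ⊥-elim (≤⇒≤ᵇ h)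
fifteen≤ 6  _ h = ⊥-elim (≤⇒≤ᵇ h)
fifteen≤ 7  _ h = ⊥-elim (≤⇒≤ᵇ h)
fifteen≤ 8  _ h = ⊥-elim (≤⇒≤ᵇ h)
fifteen≤ 9  _ h = ⊥-elim (≤⇒≤ᵇ h)
fifteen≤ 10 _ h = ⊥-elim (≤⇒≤ᵇ h)
fifteen≤ 11 _ h = ⊥-elim (≤⇒≤ᵇ h)
fifteen≤ 12 _ h = ⊥-elim (≤⇒≤ᵇ h)
fifteen≤ 13 _ h = ⊥-elim (≤⇒≤ᵇ h)
fifteen≤ 14 _ h = ⊥-elim (≤⇒≤ᵇ h)
fifteen≤ (suc (suc (suc (suc (suc (suc (suc (suc (suc (suc (suc (suc (suc (suc (suc a))))))))))))))) _ _ = m≤m+n 15 a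

sixteen≤ : ∀ s N → 3 < s → s ≤ suc N → N ^ 4 ≤ 2 ^ s → 16 ≤ s
sixteen≤ (suc a) N (s≤s 3≤a) (s≤s a≤N) N⁴≤2ˢ = s≤s (fifteen≤ a 3≤a (≤-trans (^-monoˡ-≤ 4 a≤N) N⁴≤2ˢ))

lemma3p3 : (s N : ℕ) → 3 < s → N ^ 4 ≤ 2 ^ s → 2 ^ s < suc N ^ 4 →
    Σ[ c ∈ PairColouring (suc N) ] ((S : Subset (suc N)) → ∣ S ∣ ≡ s → (k : Fin 3) → ColourOccursIn {suc N} c S k)
lemma3p3 s N 3<s N⁴≤2ˢ _ with s ≤? suc N
-- No s-subsets exist: any colouring works.
... | no s≰N+1 = (λ _ _ → zero) , λ S ∣S∣≡s → ⊥-elim (s≰N+1 (subst (_≤ suc N) ∣S∣≡s (∣p∣≤n S)))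
... | yes s≤N+1 = first-moment (suc N) s (begin-strict
  3 * #subsets (suc N) s * 2 ^ pairs s  ≤⟨ *-monoˡ-≤ (2 ^ pairs s) (*-monoʳ-≤ 3 (#subsets-≤ (suc N) s)) ⟩
  3 * suc N ^ s * 2 ^ pairs s           <⟨ union-bound (suc N) s 16≤s N+1⁴≤2ˢ⁺¹ ⟩
  3 ^ pairs s                           ∎)
  where
  open ≤-Reasoning
  16≤s : 16 ≤ s
  16≤s = sixteen≤ s N 3<s s≤N+1 N⁴≤2ˢ
  N+1⁴≤2ˢ⁺¹ : suc N ^ 4 ≤ 2 ^ suc s
  N+1⁴≤2ˢ⁺¹ = ≤-trans (succ-pow4 N (≤-trans (m≤n+m 6 9) (s≤s⁻¹ (≤-trans 16≤s s≤N+1)))) (*-monoʳ-≤ 2 N⁴≤2ˢ)
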